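{- Let $k\in\{0,1\}$, $n\geq k+3$, and let $G$ be a connected graph on $n$ vertices with exactly $k$ cut vertices, $G\not\cong K_{1,3}$. Let $B$ be a block of $G$. Then for any $u,v\in V(B)$, $f_G(u,v)\geq 2(n-k)-1$.
   Context: All graphs are simple, finite, undirected. $f_G(u,v)$ is the number of connected subgraphs of $G$ containing both $u$ and $v$ (connected subgraphs: nonempty subgraphs, i.e. vertex subsets with subsets of edges among them, that are connected; distinct subgraphs counted separately). A block is a maximal 2-connected subgraph or a bridge. -}

module Defs where

open import Data.Nat using (ℕ; zero; suc)
open import Data.Bool using (Bool; true; false; _∧_; _∨_; not)
open import Data.Fin using (Fin; _≟_)
open import Data.Vec using (Vec; lookup; tabulate; replicate)
open import Data.Product using (Σ; ∃; _×_; _,_)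
open import Relation.Nullary using (¬_)
open import Relation.Nullary.Decidable using (⌊_⌋)
open import Relation.Binary.PropositionalEquality using (_≡_; _≢_; refl)
open import Data.Sum using () renaming (_⊎_ to _⊎'_)
import Data.Fin as Fin
open import Function.Definitions using (Injective)

record Graph (n : ℕ) : Set where
  field
    adj    : Fin n → Fin n → Bool
    sym    : ∀ x y → adj x y ≡ adj y x
    irrefl : ∀ x → adj x x ≡ false
open Graph public

-- A (candidate) subgraph: a vertex subset and an edge subset, stored as
-- boolean vectors so that propositional equality is extensional equality.
record SubG (n : ℕ) : Set where
  constructor subG
  field
    vs : Vec Bool n
    es : Vec (Vec Bool n) n
open SubG public

inV : ∀ {n} → SubG n → Fin n → Set
inV H x = lookup (vs H) x ≡ true

inE : ∀ {n} → SubG n → Fin n → Fin n → Set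
inE H x y = lookup (lookup (es H) x) y ≡ true

IsSubgraph : ∀ {n} → Graph n → SubG n → Set
IsSubgraph G H =
  (∀ x y → inE H x y → inE H y x) ×
  (∀ x y → inE H x y → (adj G x y ≡ true) × inV H x × inV H y)

full : ∀ {n} → Graph n → SubG n
full G = subG (replicate _ true) (tabulate λ x → tabulate λ y → adj G x y)

_==_ : ∀ {n} → Fin n → Fin n → Bool
x == y = ⌊ x ≟ y ⌋

deleteVertex : ∀ {n} → SubG n → Fin n → SubG n
deleteVertex H w =
  subG (tabulate λ x → lookup (vs H) x ∧ not (x == w))
       (tabulate λ x → tabulate λ y →
          lookup (lookup (es H) x) y ∧ not (x == w) ∧ not (y == w))

deleteEdge : ∀ {n} → SubG n → Fin n → Fin n → SubG n
deleteEdge H a b =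
  subG (vs H)
       (tabulate λ x → tabulate λ y →
          lookup (lookup (es H) x) y ∧ not ((x == a ∧ y == b) ∨ (x == b ∧ y == a)))

data Reach {n} (H : SubG n) : Fin n → Fin n → Set where
  here : ∀ {x} → Reach H x x
  step : ∀ {x y z} → inE H x y → Reach H y z → Reach H x z

Connected : ∀ {n} → SubG n → Set
Connected H = (∃ λ x → inV H x) × (∀ x y → inV H x → inV H y → Reach H x y)

ConnectedGraph : ∀ {n} → Graph n → Set
ConnectedGraph G = Connected (full G)

IsCutVertex : ∀ {n} → Graph n → Fin n → Set
IsCutVertex G v = ¬ Connected (deleteVertex (full G) v)

ExactlyCutVertices : ∀ {n} → Graph n → ℕ → Set
ExactlyCutVertices {n} G k =
  Σ (Fin k → Fin n) λ c → Injective _≡_ _≡_ c ×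
    (∀ v → IsCutVertex G v → ∃ λ i → c i ≡ v) ×
    (∀ i → IsCutVertex G (c i))

_⊑_ : ∀ {n} → SubG n → SubG n → Set
H ⊑ K = (∀ x → inV H x → inV K x) × (∀ x y → inE H x y → inE K x y)

TwoConnected : ∀ {n} → SubG n → Set
TwoConnected H =
  (∃ λ a → ∃ λ b → ∃ λ c → inV H a × inV H b × inV H c × a ≢ b × b ≢ c × a ≢ c) ×
  Connected H ×
  (∀ w → inV H w → Connected (deleteVertex H w))

-- Block: maximal 2-connected subgraph of G, or a bridge (as a K2 subgraph).
IsBlock : ∀ {n} → Graph n → SubG n → Set
IsBlock {n} G B =
  (IsSubgraph G B × TwoConnected B ×
     (∀ K → IsSubgraph G K → TwoConnected K → B ⊑ K → K ≡ B))
  ⊎' (Σ (Fin n) λ a → Σ (Fin n) λ b →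
        adj G a b ≡ true ×
        ¬ Reach (deleteEdge (full G) a b) a b ×
        (∀ x → inV B x → (x ≡ a) ⊎' (x ≡ b)) × inV B a × inV B b ×
        (∀ x y → inE B x y → ((x ≡ a) × (y ≡ b)) ⊎' ((x ≡ b) × (y ≡ a))) ×
        inE B a b × inE B b a)

record Iso {n m : ℕ} (G : Graph n) (H : Graph m) : Set where
  field
    to      : Fin n → Fin m
    from    : Fin m → Fin n
    from∘to : ∀ x → from (to x) ≡ x
    to∘from : ∀ y → to (from y) ≡ y
    preserves : ∀ x y → adj H (to x) (to y) ≡ adj G x y

private
  k13adj : Fin 4 → Fin 4 → Bool
  k13adj Fin.zero Fin.zero = false
  k13adj Fin.zero (Fin.suc _) = true
  k13adj (Fin.suc _) Fin.zero = true
  k13adj (Fin.suc _) (Fin.suc _) = false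

  k13sym : ∀ x y → k13adj x y ≡ k13adj y x
  k13sym Fin.zero Fin.zero = refl
  k13sym Fin.zero (Fin.suc _) = refl
  k13sym (Fin.suc _) Fin.zero = refl
  k13sym (Fin.suc _) (Fin.suc _) = refl

  k13irr : ∀ x → k13adj x x ≡ false
  k13irr Fin.zero = refl
  k13irr (Fin.suc _) = refl


K13 : Graph 4
K13 = record { adj = k13adj ; sym = k13sym ; irrefl = k13irr }

AtLeast : ∀ {n} → ℕ → (SubG n → Set) → Set
AtLeast {n} m P = Σ (Fin m → SubG n) λ f → Injective _≡_ _≡_ f × (∀ i → P (f i))

ConnSubContaining : ∀ {n} → Graph n → Fin n → Fin n → SubG n → Set
ConnSubContaining G u v H = IsSubgraph G H × Connected H × inV H u × inV H v

fAtLeast : ∀ {n} → Graph n → Fin n → Fin n → ℕ → Set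
fAtLeast G u v m = AtLeast m (ConnSubContaining G u v)

module Submission where

-- Each case exhibits 2(n − k) − 1 distinct connected subgraphs containing u and v, all
-- obtained from G by deleting at most two vertices and at most one edge.
-- k = 0: G; G − w for w ∉ {u, v}; G − e for the n − 1 edges e of a shortest-path tree
-- rooted at u, and for one non-tree edge at a vertex farthest from u.  Each G − w is
-- connected, so G − e is too, as an endpoint of e has a second neighbour.
-- k = 1, cut vertex c: if some component C of G − c has an edge (C ∋ u, v unless u = v
-- or c ∈ {u, v}), take G; G − w for w ∉ {c, u, v}; G − e for the tree edges, rooted at
-- c, leaving the vertices of C; and G − e₀ − w for a fixed such edge e₀ and the vertices
-- w ∉ {u, v} of the other components.  Otherwise G is a star K₁,ₙ₋₁ with n ≥ 5, and
-- G − w₀ − w and G − w₁ − w₂ replace the edge deletions.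

open import Defs renaming (sym to adj-sym)
open import Level using (0ℓ)
open import Data.Nat using (ℕ; zero; suc; _+_; _*_; _∸_; _≤_; _<_; z≤n; s≤s; _≤?_)
import Data.Nat.Properties as ℕ
open import Data.Nat.Tactic.RingSolver using (solve-∀)
open import Data.Fin using (Fin; _≟_; inject≤) renaming (zero to fz; suc to fs)
import Data.Fin.Properties as Fin
import Data.Fin.Permutation.Components as PC
open import Data.Bool using (Bool; true; false; _∧_; _∨_; not)
import Data.Bool as Bool
import Data.Bool.Properties as Bool
open import Data.Vec using (lookup; tabulate)
open import Data.Vec.Properties using (lookup∘tabulate; lookup-replicate)
open import Data.List using (List; []; _∷_; _++_; map; filter; length; allFin)
import Data.List as List
import Data.List.Properties as List
import Data.List.Membership.Propositional.Properties as List
import Data.List.Extrema ℕ.≤-totalOrder as Extrema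
open import Data.List.Membership.Propositional using (_∈_)
open import Data.List.Relation.Unary.All as All using (All; []; _∷_)
import Data.List.Relation.Unary.All.Properties as All
import Data.List.Relation.Unary.Any as Any
open import Data.List.Relation.Unary.AllPairs using ([]; _∷_)
open import Data.List.Relation.Unary.Unique.Propositional using (Unique)
import Data.List.Relation.Unary.Unique.Propositional.Properties as Unique
open import Data.List.Relation.Binary.Disjoint.Propositional using (Disjoint)
open import Data.Product using (∃; _×_; _,_; proj₁; proj₂)
open import Data.Sum using (_⊎_; inj₁; inj₂; [_,_]′)
open import Function using (_∘′_)
open import Relation.Binary using (Rel; Decidable)
open import Relation.Binary.Construct.Closure.ReflexiveTransitive as Star using (Star; ε; _◅_; _◅◅_)
open import Relation.Nullary using (¬_; Dec; yes; no; ¬?; contradiction)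
import Relation.Nullary.Decidable as Dec
open import Relation.Nullary.Decidable
  using (_×-dec_; _→-dec_; _⊎-dec_; dec-true; dec-false; isYes≗does)
open import Relation.Binary.PropositionalEquality
  using (_≡_; _≢_; refl; sym; trans; cong; cong₂; subst; module ≡-Reasoning)

first-step : ∀ {n} {E : Rel (Fin n) 0ℓ} {x y} → Star E x y → x ≢ y → ∃ (E x)
first-step ε       x≢x = contradiction refl x≢x
first-step (e ◅ _) _   = _ , e

Outside : {A : Set} → (A → Set) → Rel A 0ℓ → Rel A 0ℓ
Outside S E x y = E x y × ¬ S x × ¬ S y

module _ {A : Set} {E : Rel A 0ℓ} (E-sym : ∀ {x y} → E x y → E y x)
         {S : A → Set} (S? : ∀ x → Dec (S x)) {c : A}
         (exit-via-c : ∀ {x y} → E x y → S x → ¬ S y → y ≡ c) where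

  -- S can only be entered from c and left to c, so every excursion into S is a
  -- closed walk at c and can be cut out.
  private
    bypass′ : ∀ {a y} → Star E a y → ¬ S y →
              (¬ S a × Star (Outside S E) a y) ⊎ (S a × Star (Outside S E) c y)
    bypass′ ε ¬Sy = inj₁ (¬Sy , ε)
    bypass′ (_◅_ {i = a} {j = b} e p) ¬Sy with bypass′ p ¬Sy | S? a
    ... | inj₁ (¬Sb , q) | no ¬Sa = inj₁ (¬Sa , (e , ¬Sa , ¬Sb) ◅ q)
    ... | inj₁ (¬Sb , q) | yes Sa = inj₂ (Sa , subst (λ t → Star (Outside S E) t _) (exit-via-c e Sa ¬Sb) q)
    ... | inj₂ (_ , q)   | yes Sa = inj₂ (Sa , q)
    ... | inj₂ (Sb , q)  | no ¬Sa =
      inj₁ (¬Sa , subst (λ t → Star (Outside S E) t _) (sym (exit-via-c (E-sym e) Sb ¬Sa)) q)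

  bypass : ∀ {a y} → Star E a y → ¬ S a → ¬ S y → Star (Outside S E) a y
  bypass p ¬Sa ¬Sy with bypass′ p ¬Sy
  ... | inj₁ (_ , q)  = q
  ... | inj₂ (Sa , _) = contradiction Sa ¬Sa

infixl 6 _∖_

_∖_ : ∀ {n} → List (Fin n) → Fin n → List (Fin n)
xs ∖ x = filter (λ z → ¬? (z ≟ x)) xs

module Reachability {n : ℕ} {E : Rel (Fin n) 0ℓ} (E? : Decidable E) where

  open import Data.List.Membership.DecPropositional (_≟_ {n}) using (_∈?_)

  private
    data PathThrough (A : List (Fin n)) : Fin n → Fin n → Set where
      ε    : ∀ {x} → PathThrough A x x
      step : ∀ {x y z} → x ∈ A → E x y → PathThrough A y z → PathThrough A x z

    through-∖⇒through : ∀ {x A a y} → PathThrough (A ∖ x) a y → PathThrough A a y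
    through-∖⇒through ε            = ε
    through-∖⇒through (step m e p) =
      step (proj₁ (List.∈-filter⁻ (λ z → ¬? (z ≟ _)) m)) e (through-∖⇒through p)

    -- Cut the path at its last visit to x.
    avoid-or-leave : ∀ {x A a y} → PathThrough A a y → y ≢ x →
                     (a ≢ x × PathThrough (A ∖ x) a y) ⊎ ∃ λ z → E x z × PathThrough (A ∖ x) z y
    avoid-or-leave ε y≢x = inj₁ (y≢x , ε)
    avoid-or-leave {x} (step {x = a} {y = b} m e p) y≢x with avoid-or-leave p y≢x
    ... | inj₂ leave = inj₂ leave
    ... | inj₁ (_ , q) with a ≟ x
    ...   | yes refl = inj₂ (b , e , q)
    ...   | no a≢x   = inj₁ (a≢x , step (List.∈-filter⁺ (λ z → ¬? (z ≟ x)) m a≢x) e q)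

    length-∖-< : ∀ {x : Fin n} {A} → x ∈ A → length (A ∖ x) < length A
    length-∖-< {x} {A} x∈A =
      List.filter-notAll (λ z → ¬? (z ≟ x)) A (Any.map (λ z≡x z≢x → z≢x (sym z≡x)) x∈A)

    pathThrough? : ∀ k A → length A ≤ k → ∀ x y → Dec (PathThrough A x y)
    pathThrough? k A |A|≤k x y with x ≟ y
    ... | yes refl = yes ε
    ... | no x≢y with x ∈? A
    ...   | no x∉A = no λ { ε → x≢y refl ; (step x∈A _ _) → x∉A x∈A }
    pathThrough? zero A |A|≤0 x y | no x≢y | yes x∈A =
      contradiction (ℕ.≤-trans (length-∖-< x∈A) |A|≤0) λ ()
    pathThrough? (suc k) A |A|≤1+k x y | no x≢y | yes x∈A =
      Dec.map′ (λ (z , e , p) → step x∈A e (through-∖⇒through p))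
               (λ p → [ (λ (x≢x , _) → contradiction refl x≢x) , (λ leave → leave) ]′
                        (avoid-or-leave p (x≢y ∘′ sym)))
               (Fin.any? λ z → E? x z ×-dec pathThrough? k (A ∖ x) |A∖x|≤k z y)
      where |A∖x|≤k = ℕ.≤-pred (ℕ.≤-trans (length-∖-< x∈A) |A|≤1+k)

    forget : ∀ {A x y} → PathThrough A x y → Star E x y
    forget ε            = ε
    forget (step _ e p) = e ◅ forget p

    remember : ∀ {x y} → Star E x y → PathThrough (allFin n) x y
    remember ε       = ε
    remember (e ◅ p) = step (List.∈-allFin _) e (remember p)

  star? : Decidable (Star E)
  star? x y = Dec.map′ forget remember (pathThrough? _ (allFin n) ℕ.≤-refl x y)

module _ {P : ℕ → Set} (P? : ∀ k → Dec (P k)) where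

  private
    least-below : ∀ m → (∃ λ j → j ≤ m × P j) → ∃ λ k → P k × ∀ {j} → P j → k ≤ j
    least-below m (j , j≤m , pj) with ℕ.anyUpTo? P? j
    ... | no none = j , pj , λ pi → ℕ.≮⇒≥ (λ i<j → none (_ , i<j , pi))
    least-below zero    (j , j≤0 , _)   | yes (i , i<j , _)  = contradiction (ℕ.≤-trans i<j j≤0) λ ()
    least-below (suc m) (j , j≤1+m , _) | yes (i , i<j , pi) =
      least-below m (i , ℕ.≤-pred (ℕ.≤-trans i<j j≤1+m) , pi)

  minimal : ∀ {m} → P m → ∃ λ k → P k × ∀ {j} → P j → k ≤ j
  minimal pm = least-below _ (_ , ℕ.≤-refl , pm)

module _ {n : ℕ} where

  private
    ≢? : (a : Fin n) → ∀ z → Dec (z ≢ a)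
    ≢? a z = ¬? (z ≟ a)

  ∖-all : ∀ {a} xs → All (_≢ a) (xs ∖ a)
  ∖-all {a} = All.all-filter (≢? a)

  ∖-All⁺ : ∀ {Q : Fin n → Set} {a xs} → All Q xs → All Q (xs ∖ a)
  ∖-All⁺ {a = a} = All.filter⁺ (≢? a)

  ∖-unique : ∀ {a xs} → Unique xs → Unique (xs ∖ a)
  ∖-unique {a} = Unique.filter⁺ (≢? a)

  ∖-id : ∀ {a xs} → All (_≢ a) xs → xs ∖ a ≡ xs
  ∖-id {a} = List.filter-all (≢? a)

  length-∖-≥ : ∀ {a xs} → Unique xs → length xs ≤ suc (length (xs ∖ a))
  length-∖-≥ {a} {[]}     _             = z≤n
  length-∖-≥ {a} {x ∷ xs} (x∉ ∷ unique) with x ≟ a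
  ... | no _     = s≤s (length-∖-≥ unique)
  ... | yes refl = s≤s (ℕ.≤-reflexive (cong length (sym (∖-id (All.map (_∘′ sym) x∉)))))

  length-allFin : length (allFin n) ≡ n
  length-allFin = List.length-tabulate (λ x → x)

  length-allFin-∖ : ∀ a → n ≤ suc (length (allFin n ∖ a))
  length-allFin-∖ a =
    subst (_≤ suc (length (allFin n ∖ a))) length-allFin (length-∖-≥ (Unique.allFin⁺ n))

  length-split : ∀ {P : Fin n → Set} (P? : ∀ x → Dec (P x)) xs →
                 length (filter P? xs) + length (filter (λ x → ¬? (P? x)) xs) ≡ length xs
  length-split P? []       = refl
  length-split P? (x ∷ xs) with P? x
  ... | yes _ = cong suc (length-split P? xs)
  ... | no _  = trans (ℕ.+-suc _ _) (cong suc (length-split P? xs))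

  module _ {u v : Fin n} where

    ∖₂-all : ∀ xs → All (λ w → w ≢ u × w ≢ v) (xs ∖ u ∖ v)
    ∖₂-all xs = All.zip (∖-All⁺ (∖-all xs) , ∖-all (xs ∖ u))

    ∖₂-All⁺ : ∀ {Q : Fin n → Set} {xs} → All Q xs → All Q (xs ∖ u ∖ v)
    ∖₂-All⁺ = ∖-All⁺ ∘′ ∖-All⁺

    ∖₂-unique : ∀ {xs} → Unique xs → Unique (xs ∖ u ∖ v)
    ∖₂-unique = ∖-unique ∘′ ∖-unique

    ∖₂-id : ∀ {xs} → All (λ w → w ≢ u × w ≢ v) xs → xs ∖ u ∖ v ≡ xs
    ∖₂-id avoid = trans (cong (_∖ v) (∖-id (All.map proj₁ avoid))) (∖-id (All.map proj₂ avoid))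

    length-∖₂-≥ : ∀ {xs} → Unique xs → length xs ≤ 2 + length (xs ∖ u ∖ v)
    length-∖₂-≥ unique = ℕ.≤-trans (length-∖-≥ unique) (s≤s (length-∖-≥ (∖-unique unique)))

    length-allFin-∖₂ : n ≤ 2 + length (allFin n ∖ u ∖ v)
    length-allFin-∖₂ =
      subst (_≤ 2 + length (allFin n ∖ u ∖ v)) length-allFin (length-∖₂-≥ (Unique.allFin⁺ n))

    length-∖₂-≥-incident : ∀ {c xs} → Unique xs → All (_≢ c) xs → u ≡ v ⊎ u ≡ c ⊎ v ≡ c →
                           length xs ≤ 1 + length (xs ∖ u ∖ v)
    length-∖₂-≥-incident {xs = xs} unique _ (inj₁ refl)
      rewrite ∖-id (∖-all {u} xs)          = length-∖-≥ unique
    length-∖₂-≥-incident unique avoid-c (inj₂ (inj₁ refl))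
      rewrite ∖-id avoid-c                  = length-∖-≥ unique
    length-∖₂-≥-incident unique avoid-c (inj₂ (inj₂ refl))
      rewrite ∖-id (∖-All⁺ {a = u} avoid-c) = length-∖-≥ unique

module _ {A : Set} where

  lookup-injective : ∀ {xs : List A} → Unique xs → ∀ {i j} → List.lookup xs i ≡ List.lookup xs j → i ≡ j
  lookup-injective (_ ∷ _)      {fz}   {fz}   _  = refl
  lookup-injective (x∉ ∷ _)     {fz}   {fs j} eq = contradiction eq (All.lookup x∉ (List.∈-lookup j))
  lookup-injective (x∉ ∷ _)     {fs i} {fz}   eq = contradiction (sym eq) (All.lookup x∉ (List.∈-lookup i))
  lookup-injective (_ ∷ unique) {fs i} {fs j} eq = cong fs (lookup-injective unique eq)

  module _ {B : Set} {Q : A → Set} {f : A → B} (injective : ∀ {x y} → Q x → Q y → f x ≡ f y → x ≡ y) where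

    unique-map⁺ : ∀ {xs} → All Q xs → Unique xs → Unique (map f xs)
    unique-map⁺ []       []            = []
    unique-map⁺ (q ∷ qs) (x∉ ∷ unique) = fx∉ q qs x∉ ∷ unique-map⁺ qs unique
      where fx∉ : ∀ {x xs} → Q x → All Q xs → All (x ≢_) xs → All (f x ≢_) (map f xs)
            fx∉ _  []        []         = []
            fx∉ qx (qy ∷ qs) (x≢y ∷ x∉) = (x≢y ∘′ injective qx qy) ∷ fx∉ qx qs x∉

  module _ {A′ B : Set} {Q : A → Set} {Q′ : A′ → Set} {f : A → B} {g : A′ → B}
           (apart : ∀ {x y} → Q x → Q′ y → f x ≢ g y) where

    disjoint-map : ∀ {xs ys} → All Q xs → All Q′ ys → Disjoint (map f xs) (map g ys)
    disjoint-map qs q′s (fx∈ , gy∈) with List.∈-map⁻ f fx∈ | List.∈-map⁻ g gy∈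
    ... | x , x∈ , refl | y , y∈ , fx≡gy = apart (All.lookup qs x∈) (All.lookup q′s y∈) fx≡gy

  unique-++₃ : ∀ {xs ys zs : List A} → Unique xs → Unique ys → Unique zs →
               Disjoint xs ys → Disjoint xs zs → Disjoint ys zs → Unique (xs ++ ys ++ zs)
  unique-++₃ {ys = ys} ux uy uz dxy dxz dyz = Unique.++⁺ ux (Unique.++⁺ uy uz dyz) disjoint
    where disjoint : Disjoint _ (ys ++ _)
          disjoint (v∈xs , v∈ys++zs) with List.∈-++⁻ ys v∈ys++zs
          ... | inj₁ v∈ys = dxy (v∈xs , v∈ys)
          ... | inj₂ v∈zs = dxz (v∈xs , v∈zs)

module _ {A B C D : Set} (h : D) (f : A → D) (g : B → D) (k : C → D) where

  length-∷-map++₃ : ∀ xs ys zs →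
                    length (h ∷ map f xs ++ map g ys ++ map k zs) ≡ suc (length xs + (length ys + length zs))
  length-∷-map++₃ xs ys zs = cong suc (begin
    length (map f xs ++ map g ys ++ map k zs)
      ≡⟨ List.length-++ (map f xs) ⟩
    length (map f xs) + length (map g ys ++ map k zs)
      ≡⟨ cong (length (map f xs) +_) (List.length-++ (map g ys)) ⟩
    length (map f xs) + (length (map g ys) + length (map k zs))
      ≡⟨ cong₂ _+_ (List.length-map f xs) (cong₂ _+_ (List.length-map g ys) (List.length-map k zs)) ⟩
    length xs + (length ys + length zs)
      ∎)
    where open ≡-Reasoning

atLeast-list : ∀ {n} {P : SubG n → Set} (L : List (SubG n)) → Unique L → All P L → AtLeast (length L) P
atLeast-list L unique all =
  List.lookup L , lookup-injective unique , λ i → All.lookup all (List.∈-lookup i)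

atLeast-≤ : ∀ {n m m′} {P : SubG n → Set} → AtLeast m P → m′ ≤ m → AtLeast m′ P
atLeast-≤ (f , f-injective , Pf) m′≤m =
  (λ i → f (inject≤ i m′≤m)) ,
  (λ eq → Fin.inject≤-injective m′≤m m′≤m _ _ (f-injective eq)) ,
  (λ i → Pf (inject≤ i m′≤m))

2*[n∸1]∸1≤ : ∀ {n k m} → n ≤ suc k → 2 * k ≤ suc m → 2 * (n ∸ 1) ∸ 1 ≤ m
2*[n∸1]∸1≤ n≤1+k 2k≤1+m =
  ℕ.∸-monoˡ-≤ 1 (ℕ.≤-trans (ℕ.*-monoʳ-≤ 2 (ℕ.∸-monoˡ-≤ 1 n≤1+k)) 2k≤1+m)

module _ {n : ℕ} where

  ==-refl : (x : Fin n) → (x == x) ≡ true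
  ==-refl x = trans (isYes≗does (x ≟ x)) (dec-true (x ≟ x) refl)

  ==-≢ : {x y : Fin n} → x ≢ y → (x == y) ≡ false
  ==-≢ {x} {y} x≢y = trans (isYes≗does (x ≟ y)) (dec-false (x ≟ y) x≢y)

  ==⇒≡ : {x y : Fin n} → (x == y) ≡ true → x ≡ y
  ==⇒≡ {x} {y} x==y with x ≟ y
  ... | yes x≡y = x≡y

  ==-false⇒≢ : {x y : Fin n} → (x == y) ≡ false → x ≢ y
  ==-false⇒≢ {x} x==y refl with () ← trans (sym (==-refl x)) x==y

  Reach⇒Star : ∀ {H : SubG n} {x y} → Reach H x y → Star (inE H) x y
  Reach⇒Star here       = ε
  Reach⇒Star (step e r) = e ◅ Reach⇒Star r

  Star⇒Reach : ∀ {H : SubG n} {x y} → Star (inE H) x y → Reach H x y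
  Star⇒Reach ε       = here
  Star⇒Reach (e ◅ p) = step e (Star⇒Reach p)

  lookup-tabulate² : (f : Fin n → Fin n → Bool) (x y : Fin n) →
                     lookup (lookup (tabulate λ a → tabulate (f a)) x) y ≡ f x y
  lookup-tabulate² f x y rewrite lookup∘tabulate (λ a → tabulate (f a)) x = lookup∘tabulate (f x) y

third-vertex : ∀ {n} → 3 ≤ n → (a b : Fin n) → ∃ λ z → z ≢ a × z ≢ b
third-vertex {suc (suc zero)} (s≤s (s≤s ()))
third-vertex {suc (suc (suc _))} _ a b with fz ≟ a | fz ≟ b
... | no 0≢a   | no 0≢b = fz , 0≢a , 0≢b
... | yes refl | _ with fs fz ≟ b
...   | no 1≢b   = fs fz , (λ ()) , 1≢b
...   | yes refl = fs (fs fz) , (λ ()) , (λ ())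
third-vertex {suc (suc (suc _))} _ a b | no _ | yes refl with fs fz ≟ a
...   | no 1≢a   = fs fz , 1≢a , (λ ())
...   | yes refl = fs (fs fz) , (λ ()) , (λ ())

module Adjacency {n : ℕ} (G : Graph n) where

  Adj : Rel (Fin n) 0ℓ
  Adj x y = adj G x y ≡ true

  Adj-sym : ∀ {x y} → Adj x y → Adj y x
  Adj-sym {x} {y} xy = trans (adj-sym G y x) xy

  Adj⇒≢ : ∀ {x y} → Adj x y → x ≢ y
  Adj⇒≢ {x} xx refl with () ← trans (sym xx) (irrefl G x)

  Adj? : Decidable Adj
  Adj? x y = adj G x y Bool.≟ true

  AdjAvoiding : Fin n → Rel (Fin n) 0ℓ
  AdjAvoiding w x y = Adj x y × x ≢ w × y ≢ w

  AdjAvoiding-sym : ∀ {w x y} → AdjAvoiding w x y → AdjAvoiding w y x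
  AdjAvoiding-sym (xy , x≢w , y≢w) = Adj-sym xy , y≢w , x≢w

  AdjAvoiding? : ∀ w → Decidable (AdjAvoiding w)
  AdjAvoiding? w x y = Adj? x y ×-dec ¬? (x ≟ w) ×-dec ¬? (y ≟ w)

  Linked : Set
  Linked = ∀ x y → Star Adj x y

  LinkedAvoiding : Fin n → Set
  LinkedAvoiding w = ∀ x y → x ≢ w → y ≢ w → Star (AdjAvoiding w) x y

  connected? : (H : SubG n) → Dec (Connected H)
  connected? H = Fin.any? (λ x → lookup (vs H) x Bool.≟ true) ×-dec
                 Fin.all? λ x → Fin.all? λ y →
                   (lookup (vs H) x Bool.≟ true) →-dec (lookup (vs H) y Bool.≟ true) →-dec
                   Dec.map′ Star⇒Reach Reach⇒Star
                     (Reachability.star? (λ a b → lookup (lookup (es H) a) b Bool.≟ true) x y)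

  full-inV : ∀ x → inV (full G) x
  full-inV x = lookup-replicate x true

  full-inE⁻ : ∀ {x y} → inE (full G) x y → Adj x y
  full-inE⁻ {x} {y} e = trans (sym (lookup-tabulate² (adj G) x y)) e

  module _ {H : SubG n} {w : Fin n} where

    deleteVertex-inV : ∀ {x} → inV H x → x ≢ w → inV (deleteVertex H w) x
    deleteVertex-inV {x} x∈H x≢w
      rewrite lookup∘tabulate (λ x → lookup (vs H) x ∧ not (x == w)) x | x∈H | ==-≢ x≢w = refl

    deleteVertex-inE⁻ : ∀ {x y} → inE (deleteVertex H w) x y → inE H x y × x ≢ w × y ≢ w
    deleteVertex-inE⁻ {x} {y} e
      rewrite lookup-tabulate² (λ a b → lookup (lookup (es H) a) b ∧ not (a == w) ∧ not (b == w)) x y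
      with lookup (lookup (es H) x) y | x == w in x==w | y == w in y==w
    ... | true | false | false = refl , ==-false⇒≢ x==w , ==-false⇒≢ y==w

  connected⇒linked : ConnectedGraph G → Linked
  connected⇒linked (_ , reach) x y =
    Star.map full-inE⁻ (Reach⇒Star (reach x y (full-inV x) (full-inV y)))

  nonCut⇒linkedAvoiding : ∀ w → ¬ IsCutVertex G w → LinkedAvoiding w
  nonCut⇒linkedAvoiding w nonCut x y x≢w y≢w with connected? (deleteVertex (full G) w)
  ... | no disconnected = contradiction disconnected nonCut
  ... | yes (_ , reach) = Star.map kept (Reach⇒Star (reach x y (x∈ x≢w) (x∈ y≢w)))
    where
    x∈ : ∀ {x} → x ≢ w → inV (deleteVertex (full G) w) x
    x∈ x≢w = deleteVertex-inV {H = full G} (full-inV _) x≢w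
    kept : ∀ {x y} → inE (deleteVertex (full G) w) x y → AdjAvoiding w x y
    kept e = let (xy , x≢w , y≢w) = deleteVertex-inE⁻ {H = full G} e in full-inE⁻ xy , x≢w , y≢w

  block-linkedAvoiding : ∀ {B} → IsBlock G B → ∀ {u v c} → inV B u → inV B v → u ≢ c → v ≢ c →
                         Star (AdjAvoiding c) u v
  block-linkedAvoiding {B} (inj₁ ((_ , B⊆G) , (_ , B-connected , B-robust) , _)) {u} {v} {c} u∈B v∈B u≢c v≢c
    with lookup (vs B) c Bool.≟ true
  ... | yes c∈B = Star.map kept (Reach⇒Star (proj₂ (B-robust c c∈B) u v (x∈ u∈B u≢c) (x∈ v∈B v≢c)))
    where
    x∈ : ∀ {x} → inV B x → x ≢ c → inV (deleteVertex B c) x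
    x∈ = deleteVertex-inV {H = B}
    kept : ∀ {x y} → inE (deleteVertex B c) x y → AdjAvoiding c x y
    kept e = let (xy , x≢c , y≢c) = deleteVertex-inE⁻ {H = B} e in proj₁ (B⊆G _ _ xy) , x≢c , y≢c
  ... | no c∉B = Star.map kept (Reach⇒Star (proj₂ B-connected u v u∈B v∈B))
    where
    kept : ∀ {x y} → inE B x y → AdjAvoiding c x y
    kept {x} {y} e = let (xy , x∈B , y∈B) = B⊆G x y e in xy , avoid x∈B , avoid y∈B
      where avoid : ∀ {x} → inV B x → x ≢ c
            avoid x∈B refl = c∉B x∈B
  block-linkedAvoiding (inj₂ (a , b , ab , _ , within , _)) {u} {v} u∈B v∈B u≢c v≢c
    with within u u∈B | within v v∈B
  ... | inj₁ refl | inj₁ refl = ε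
  ... | inj₂ refl | inj₂ refl = ε
  ... | inj₁ refl | inj₂ refl = (ab , u≢c , v≢c) ◅ ε
  ... | inj₂ refl | inj₁ refl = (Adj-sym ab , u≢c , v≢c) ◅ ε

  another-neighbour : 3 ≤ n → ∀ {w y} → LinkedAvoiding y → Adj w y → ∃ λ w′ → Adj w w′ × w′ ≢ y
  another-neighbour 3≤n {w} {y} linked wy with third-vertex 3≤n w y
  ... | z , z≢w , z≢y with first-step (linked w z (Adj⇒≢ wy) z≢y) (z≢w ∘′ sym)
  ... | w′ , ww′ , _ , w′≢y = w′ , ww′ , w′≢y

module Spanning {n : ℕ} (G : Graph n) where
  open Adjacency G

  keepsᵇ : (Fin n → Bool) → (Fin n → Fin n → Bool) → Fin n → Fin n → Bool
  keepsᵇ D F x y = adj G x y ∧ not (D x) ∧ not (D y) ∧ not (F x y)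

  remove : (Fin n → Bool) → (Fin n → Fin n → Bool) → SubG n
  remove D F = subG (tabulate λ x → not (D x)) (tabulate λ x → tabulate (keepsᵇ D F x))

  Keeps : (Fin n → Bool) → (Fin n → Fin n → Bool) → Rel (Fin n) 0ℓ
  Keeps D F x y = Adj x y × D x ≡ false × D y ≡ false × F x y ≡ false

  SymmetricSet : (Fin n → Fin n → Bool) → Set
  SymmetricSet F = ∀ x y → F x y ≡ F y x

  module _ {D : Fin n → Bool} {F : Fin n → Fin n → Bool} where

    inV-remove : ∀ {x} → D x ≡ false → inV (remove D F) x
    inV-remove {x} Dx rewrite lookup∘tabulate (λ x → not (D x)) x | Dx = refl

    inV-remove⁻ : ∀ {x} → inV (remove D F) x → D x ≡ false
    inV-remove⁻ {x} x∈ rewrite lookup∘tabulate (λ x → not (D x)) x = Bool.not-injective x∈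

    Keeps⇒inE : ∀ {x y} → Keeps D F x y → inE (remove D F) x y
    Keeps⇒inE {x} {y} (xy , Dx , Dy , Fxy)
      rewrite lookup-tabulate² (keepsᵇ D F) x y | xy | Dx | Dy | Fxy = refl

    inE⇒Keeps : ∀ {x y} → inE (remove D F) x y → Keeps D F x y
    inE⇒Keeps {x} {y} e rewrite lookup-tabulate² (keepsᵇ D F) x y
      with adj G x y | D x | D y | F x y
    ... | true | false | false | false = refl , refl , refl , refl

    Keeps-sym : SymmetricSet F → ∀ {x y} → Keeps D F x y → Keeps D F y x
    Keeps-sym F-sym {x} {y} (xy , Dx , Dy , Fxy) = Adj-sym xy , Dy , Dx , trans (F-sym y x) Fxy

    remove-isSubgraph : SymmetricSet F → IsSubgraph G (remove D F)
    remove-isSubgraph F-sym =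
      (λ x y e → Keeps⇒inE (Keeps-sym F-sym (inE⇒Keeps e))) ,
      (λ x y e → let (xy , Dx , Dy , _) = inE⇒Keeps e in xy , inV-remove Dx , inV-remove Dy)

    remove-connected : SymmetricSet F → (hub : Fin n) → D hub ≡ false →
                       (∀ x → D x ≡ false → Star (Keeps D F) x hub) → Connected (remove D F)
    remove-connected F-sym hub D-hub to-hub = (hub , inV-remove D-hub) , λ x y x∈ y∈ →
      Star⇒Reach (Star.map Keeps⇒inE
        (to-hub x (inV-remove⁻ x∈) ◅◅ Star.reverse (Keeps-sym F-sym) (to-hub y (inV-remove⁻ y∈))))

    remove-contains : SymmetricSet F → Connected (remove D F) →
                      ∀ {u v} → D u ≡ false → D v ≡ false → ConnSubContaining G u v (remove D F)
    remove-contains F-sym conn Du Dv = remove-isSubgraph F-sym , conn , inV-remove Du , inV-remove Dv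

  module _ {D D′ : Fin n → Bool} {F F′ : Fin n → Fin n → Bool} where

    remove-≢ᵛ : ∀ x → D x ≢ D′ x → remove D F ≢ remove D′ F′
    remove-≢ᵛ x Dx≢D′x eq = Dx≢D′x (Bool.not-injective (begin
      not (D x)                    ≡⟨ lookup∘tabulate (λ x → not (D x)) x ⟨
      lookup (vs (remove D F)) x   ≡⟨ cong (λ H → lookup (vs H) x) eq ⟩
      lookup (vs (remove D′ F′)) x ≡⟨ lookup∘tabulate (λ x → not (D′ x)) x ⟩
      not (D′ x)                   ∎))
      where open ≡-Reasoning

    remove-≡⇒keepsᵇ : remove D F ≡ remove D′ F′ → ∀ x y → keepsᵇ D F x y ≡ keepsᵇ D′ F′ x y
    remove-≡⇒keepsᵇ eq x y = begin
      keepsᵇ D F x y                              ≡⟨ lookup-tabulate² (keepsᵇ D F) x y ⟨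
      lookup (lookup (es (remove D F)) x) y       ≡⟨ cong (λ H → lookup (lookup (es H) x) y) eq ⟩
      lookup (lookup (es (remove D′ F′)) x) y     ≡⟨ lookup-tabulate² (keepsᵇ D′ F′) x y ⟩
      keepsᵇ D′ F′ x y                            ∎
      where open ≡-Reasoning

    remove-≢ᵉ : ∀ x y → keepsᵇ D F x y ≢ keepsᵇ D′ F′ x y → remove D F ≢ remove D′ F′
    remove-≢ᵉ x y differ eq = differ (remove-≡⇒keepsᵇ eq x y)

  noVertices : Fin n → Bool
  noVertices _ = false

  noEdges : Fin n → Fin n → Bool
  noEdges _ _ = false

  edge : Fin n → Fin n → Fin n → Fin n → Bool
  edge a b x y = (x == a ∧ y == b) ∨ (x == b ∧ y == a)

  noEdges-sym : SymmetricSet noEdges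
  noEdges-sym _ _ = refl

  edge-sym : ∀ a b → SymmetricSet (edge a b)
  edge-sym a b x y rewrite Bool.∧-comm (x == a) (y == b) | Bool.∧-comm (x == b) (y == a) =
    Bool.∨-comm (y == b ∧ x == a) (y == a ∧ x == b)

  edge-self : ∀ a b → edge a b a b ≡ true
  edge-self a b rewrite ==-refl a | ==-refl b = refl

  edge-away : ∀ {a b x y} → x ≢ a → y ≢ a → edge a b x y ≡ false
  edge-away {a} {b} {x} {y} x≢a y≢a rewrite ==-≢ x≢a | ==-≢ y≢a = Bool.∧-zeroʳ _

  edge⁻ : ∀ {a b x y} → edge a b x y ≡ true → (x ≡ a × y ≡ b) ⊎ (x ≡ b × y ≡ a)
  edge⁻ {a} {b} {x} {y} e with x == a in x==a | y == b in y==b | x == b in x==b | y == a in y==a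
  ... | true | true | _    | _    = inj₁ (==⇒≡ x==a , ==⇒≡ y==b)
  ... | true | false | true | true = inj₂ (==⇒≡ x==b , ==⇒≡ y==a)
  ... | false | _    | true | true = inj₂ (==⇒≡ x==b , ==⇒≡ y==a)

  whole : SubG n
  whole = remove noVertices noEdges

  minusV : Fin n → SubG n
  minusV w = remove (_== w) noEdges

  minusE : Fin n → Fin n → SubG n
  minusE a b = remove noVertices (edge a b)

  minusEV : Fin n → Fin n → Fin n → SubG n
  minusEV a b w = remove (_== w) (edge a b)

  minusVV : Fin n → Fin n → SubG n
  minusVV p q = remove (λ x → x == p ∨ x == q) noEdges

  ∈pairˡ : (p q : Fin n) → (p == p ∨ p == q) ≡ true
  ∈pairˡ p q = cong (_∨ (p == q)) (==-refl p)

  ∈pairʳ : (p q : Fin n) → (q == p ∨ q == q) ≡ true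
  ∈pairʳ p q = trans (cong ((q == p) ∨_) (==-refl q)) (Bool.∨-zeroʳ _)

  ∉pair : {x p q : Fin n} → x ≢ p → x ≢ q → (x == p ∨ x == q) ≡ false
  ∉pair x≢p x≢q rewrite ==-≢ x≢p | ==-≢ x≢q = refl

  whole-connected : Linked → Fin n → Connected whole
  whole-connected linked hub = remove-connected noEdges-sym hub refl λ x _ →
    Star.map (λ xy → xy , refl , refl , refl) (linked x hub)

  minusV-connected : ∀ {w} → LinkedAvoiding w → ∀ hub → hub ≢ w → Connected (minusV w)
  minusV-connected {w} linked hub hub≢w = remove-connected noEdges-sym hub (==-≢ hub≢w) λ x x==w →
    Star.map (λ (xy , x≢w , y≢w) → xy , ==-≢ x≢w , ==-≢ y≢w , refl)
             (linked x hub (==-false⇒≢ x==w) hub≢w)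

  -- In G − w every vertex reaches y; in G − wy, w reaches y through its other neighbour w′.
  module _ {w y : Fin n} (linked : LinkedAvoiding w) (wy : Adj w y) where

    private
      keep : ∀ {p q} → AdjAvoiding w p q → Keeps noVertices (edge w y) p q
      keep (pq , p≢w , q≢w) = pq , refl , refl , edge-away p≢w q≢w

      reaches-from : ∀ {x} → x ≢ w → Star (Keeps noVertices (edge w y)) x y
      reaches-from x≢w = Star.map keep (linked _ y x≢w (Adj⇒≢ wy ∘′ sym))

    minusE-reaches : ∀ {w′} → Adj w w′ → w′ ≢ y → ∀ x → Star (Keeps noVertices (edge w y)) x y
    minusE-reaches {w′} ww′ w′≢y x with x ≟ w
    ... | no x≢w   = reaches-from x≢w
    ... | yes refl = (ww′ , refl , refl , not-wy) ◅ reaches-from (Adj⇒≢ ww′ ∘′ sym)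
      where
      not-wy : edge x y x w′ ≡ false
      not-wy rewrite ==-refl x | ==-≢ w′≢y | ==-≢ (Adj⇒≢ wy) = refl

    minusE-connected : ∀ {w′} → Adj w w′ → w′ ≢ y → Connected (minusE w y)
    minusE-connected ww′ w′≢y =
      remove-connected (edge-sym w y) y refl λ x _ → minusE-reaches ww′ w′≢y x

  private
    differ : ∀ {a b : Bool} → a ≡ false → b ≡ true → a ≢ b
    differ refl refl ()

  whole≢minusV : ∀ w → whole ≢ minusV w
  whole≢minusV w = remove-≢ᵛ w (differ refl (==-refl w))

  whole≢minusE : ∀ {a b} → Adj a b → whole ≢ minusE a b
  whole≢minusE {a} {b} ab = remove-≢ᵉ a b differs
    where differs : keepsᵇ noVertices noEdges a b ≢ keepsᵇ noVertices (edge a b) a b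
          differs rewrite ab | edge-self a b = λ ()

  whole≢minusEV : ∀ a b w → whole ≢ minusEV a b w
  whole≢minusEV a b w = remove-≢ᵛ w (differ refl (==-refl w))

  whole≢minusVV : ∀ p q → whole ≢ minusVV p q
  whole≢minusVV p q = remove-≢ᵛ p (differ refl (∈pairˡ p q))

  minusV≢minusE : ∀ w a b → minusV w ≢ minusE a b
  minusV≢minusE w a b = remove-≢ᵛ w (differ refl (==-refl w) ∘′ sym)

  minusE≢minusEV : ∀ a b a′ b′ w → minusE a b ≢ minusEV a′ b′ w
  minusE≢minusEV a b a′ b′ w = remove-≢ᵛ w (differ refl (==-refl w))

  minusV-injective : ∀ {w w′} → minusV w ≡ minusV w′ → w ≡ w′
  minusV-injective {w} {w′} eq with w ≟ w′
  ... | yes w≡w′ = w≡w′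
  ... | no w≢w′  = contradiction eq (remove-≢ᵛ w (differ (==-≢ w≢w′) (==-refl w) ∘′ sym))

  minusEV-injective : ∀ {a b w w′} → minusEV a b w ≡ minusEV a b w′ → w ≡ w′
  minusEV-injective {w = w} {w′} eq with w ≟ w′
  ... | yes w≡w′ = w≡w′
  ... | no w≢w′  = contradiction eq (remove-≢ᵛ w (differ (==-≢ w≢w′) (==-refl w) ∘′ sym))

  minusV≢minusEV : ∀ {a b w w′} → Adj a b → a ≢ w′ → b ≢ w′ → minusV w ≢ minusEV a b w′
  minusV≢minusEV {a} {b} {w} {w′} ab a≢w′ b≢w′ with w′ ≟ w
  ... | no w′≢w  = remove-≢ᵛ w′ (differ (==-≢ w′≢w) (==-refl w′))
  ... | yes refl = remove-≢ᵉ a b differs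
    where differs : keepsᵇ (_== w) noEdges a b ≢ keepsᵇ (_== w) (edge a b) a b
          differs rewrite ab | ==-≢ a≢w′ | ==-≢ b≢w′ | edge-self a b = λ ()

  minusVV-injective : ∀ {p x y} → x ≢ p → minusVV p x ≡ minusVV p y → x ≡ y
  minusVV-injective {p} {x} {y} x≢p eq with x ≟ y
  ... | yes x≡y = x≡y
  ... | no x≢y  = contradiction eq (remove-≢ᵛ x (differ (∉pair x≢p x≢y) (∈pairʳ p x) ∘′ sym))

  minusV≢minusVV : ∀ {w p q} → p ≢ q → minusV w ≢ minusVV p q
  minusV≢minusVV {w} {p} {q} p≢q with p ≟ w
  ... | no p≢w   = remove-≢ᵛ p (differ (==-≢ p≢w) (∈pairˡ p q))
  ... | yes refl = remove-≢ᵛ q (differ (==-≢ (p≢q ∘′ sym)) (∈pairʳ p q))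

  minusVV≢minusVV : ∀ {p x q y} → p ≢ q → p ≢ y → minusVV p x ≢ minusVV q y
  minusVV≢minusVV {p} {x} p≢q p≢y = remove-≢ᵛ p (differ (∉pair p≢q p≢y) (∈pairˡ p x) ∘′ sym)

  minusE-endpoints : ∀ {a b a′ b′} → Adj a b → minusE a b ≡ minusE a′ b′ →
                     (a ≡ a′ × b ≡ b′) ⊎ (a ≡ b′ × b ≡ a′)
  minusE-endpoints {a} {b} {a′} {b′} ab eq with remove-≡⇒keepsᵇ eq a b
  ... | same rewrite ab | edge-self a b with edge a′ b′ a b in a′b′
  ...   | true = edge⁻ a′b′

  whole-contains : Linked → ∀ {u v} → ConnSubContaining G u v whole
  whole-contains linked {u} = remove-contains noEdges-sym (whole-connected linked u) refl refl

  minusV-contains : ∀ {w u v} → LinkedAvoiding w → u ≢ w → v ≢ w → ConnSubContaining G u v (minusV w)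
  minusV-contains linked u≢w v≢w =
    remove-contains noEdges-sym (minusV-connected linked _ u≢w) (==-≢ u≢w) (==-≢ v≢w)

  minusE-contains : ∀ {a b a′ u v} → LinkedAvoiding a → Adj a b → Adj a a′ → a′ ≢ b →
                    ConnSubContaining G u v (minusE a b)
  minusE-contains {a} {b} linked ab aa′ a′≢b =
    remove-contains (edge-sym a b) (minusE-connected linked ab aa′ a′≢b) refl refl

module Distance {n : ℕ} (G : Graph n) (linked : Adjacency.Linked G) (root : Fin n) where
  open Adjacency G
  open Spanning G

  WithinSteps : ℕ → Fin n → Set
  WithinSteps zero    w = w ≡ root
  WithinSteps (suc k) w = w ≡ root ⊎ ∃ λ z → Adj w z × WithinSteps k z

  withinSteps? : ∀ k w → Dec (WithinSteps k w)
  withinSteps? zero    w = w ≟ root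
  withinSteps? (suc k) w = (w ≟ root) ⊎-dec Fin.any? (λ z → Adj? w z ×-dec withinSteps? k z)

  star⇒withinSteps : ∀ {w} → Star Adj w root → ∃ λ k → WithinSteps k w
  star⇒withinSteps ε        = 0 , refl
  star⇒withinSteps (wz ◅ p) = let (k , zk) = star⇒withinSteps p in suc k , inj₂ (_ , wz , zk)

  -- Abstract so that dist and farthest never unfold into the search during unification.
  private abstract
    shortest : ∀ w → ∃ λ k → WithinSteps k w × ∀ {j} → WithinSteps j w → k ≤ j
    shortest w = minimal (λ k → withinSteps? k w) (proj₂ (star⇒withinSteps (linked w root)))

  dist : Fin n → ℕ
  dist w = proj₁ (shortest w)

  within-dist : ∀ w → WithinSteps (dist w) w
  within-dist w = proj₁ (proj₂ (shortest w))

  dist-minimal : ∀ {w j} → WithinSteps j w → dist w ≤ j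
  dist-minimal = proj₂ (proj₂ (shortest _))

  dist≡0⇒root : ∀ {w} → dist w ≡ 0 → w ≡ root
  dist≡0⇒root {w} d≡0 = subst (λ k → WithinSteps k w) d≡0 (within-dist w)

  private
    closer : ∀ {w} k → WithinSteps k w → w ≢ root → ∃ λ z → Adj w z × dist z < k
    closer zero    w≡r                  w≢r = contradiction w≡r w≢r
    closer (suc k) (inj₁ w≡r)           w≢r = contradiction w≡r w≢r
    closer (suc k) (inj₂ (z , wz , zk)) _   = z , wz , s≤s (dist-minimal zk)

  parent : Fin n → Fin n
  parent w with w ≟ root
  ... | yes _   = root
  ... | no w≢r = proj₁ (closer _ (within-dist w) w≢r)

  private
    parent-spec : ∀ {w} → w ≢ root → Adj w (parent w) × dist (parent w) < dist w
    parent-spec {w} w≢r with w ≟ root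
    ... | yes w≡r  = contradiction w≡r w≢r
    ... | no w≢r′ = proj₂ (closer _ (within-dist w) w≢r′)

  parent-adj : ∀ {w} → w ≢ root → Adj w (parent w)
  parent-adj w≢r = proj₁ (parent-spec w≢r)

  parent-closer : ∀ {w} → w ≢ root → dist (parent w) < dist w
  parent-closer w≢r = proj₂ (parent-spec w≢r)

  parents-not-mutual : ∀ {w w′} → w ≢ root → w′ ≢ root → w ≡ parent w′ → w′ ≢ parent w
  parents-not-mutual {w} {w′} w≢r w′≢r w≡pw′ w′≡pw = ℕ.<-asym
    (subst (λ t → dist t < dist w′) (sym w≡pw′) (parent-closer w′≢r))
    (subst (λ t → dist t < dist w) (sym w′≡pw) (parent-closer w≢r))

  treeEdge : Fin n → SubG n
  treeEdge w = minusE w (parent w)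

  treeEdge-injective : ∀ {w w′} → w ≢ root → w′ ≢ root → treeEdge w ≡ treeEdge w′ → w ≡ w′
  treeEdge-injective w≢r w′≢r eq with minusE-endpoints (parent-adj w≢r) eq
  ... | inj₁ (w≡w′ , _)       = w≡w′
  ... | inj₂ (w≡pw′ , pw≡w′) = contradiction (sym pw≡w′) (parents-not-mutual w≢r w′≢r w≡pw′)

  abstract
    farthest : Fin n
    farthest = Extrema.argmax dist root (allFin n)

    dist≤farthest : ∀ w → dist w ≤ dist farthest
    dist≤farthest w = All.lookup (Extrema.f[xs]≤f[argmax] root (allFin n)) (List.∈-allFin w)

  farthest≢root : ∀ {w} → w ≢ root → farthest ≢ root
  farthest≢root {w} w≢r farthest≡r = w≢r (dist≡0⇒root (ℕ.n≤0⇒n≡0 (begin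
    dist w        ≤⟨ dist≤farthest w ⟩
    dist farthest ≡⟨ cong dist farthest≡r ⟩
    dist root     ≤⟨ dist-minimal {root} {0} refl ⟩
    0             ∎)))
    where open ℕ.≤-Reasoning

module NoCutVertex {n : ℕ} (G : Graph n) (3≤n : 3 ≤ n) (linked : Adjacency.Linked G)
                   (nonCut : ∀ w → Adjacency.LinkedAvoiding G w) (u v : Fin n) where
  open Adjacency G
  open Spanning G
  open Distance G linked u

  private
    farthest≢u : farthest ≢ u
    farthest≢u = let (w , w≢u , _) = third-vertex 3≤n u u in farthest≢root w≢u

    beyond-farthest : ∃ λ y → Adj farthest y × y ≢ parent farthest
    beyond-farthest = another-neighbour 3≤n (nonCut _) (parent-adj farthest≢u)

  y : Fin n
  y = proj₁ beyond-farthest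

  Vs : List (Fin n)
  Vs = allFin n ∖ u ∖ v

  Es : List (Fin n)
  Es = allFin n ∖ u

  family : List (SubG n)
  family = whole ∷ map minusV Vs ++ map treeEdge Es ++ map (λ w → minusE w y) (farthest ∷ [])

  private
    farthest-y : Adj farthest y
    farthest-y = proj₁ (proj₂ beyond-farthest)

    y≢parent : y ≢ parent farthest
    y≢parent = proj₂ (proj₂ beyond-farthest)

    all-Vs : All (λ w → w ≢ u × w ≢ v) Vs
    all-Vs = ∖₂-all (allFin n)

    all-Es : All (_≢ u) Es
    all-Es = ∖-all (allFin n)

    is-farthest : All (_≡ farthest) (farthest ∷ [])
    is-farthest = refl ∷ []

    treeEdge-contains : ∀ {w} → w ≢ u → ConnSubContaining G u v (treeEdge w)
    treeEdge-contains w≢u with another-neighbour 3≤n (nonCut _) (parent-adj w≢u)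
    ... | w′ , ww′ , w′≢pw = minusE-contains (nonCut _) (parent-adj w≢u) ww′ w′≢pw

    -- y is not the parent of farthest, nor its child since no vertex is farther from u.
    treeEdge≢extra : ∀ {w x} → w ≢ u → x ≡ farthest → treeEdge w ≢ minusE x y
    treeEdge≢extra w≢u refl eq with minusE-endpoints (parent-adj w≢u) eq
    ... | inj₁ (w≡f , pw≡y) = y≢parent (trans (sym pw≡y) (cong parent w≡f))
    ... | inj₂ (_ , pw≡f)   = ℕ.<-irrefl refl (ℕ.<-≤-trans farthest<w (dist≤farthest _))
      where farthest<w = subst (λ t → dist t < dist _) pw≡f (parent-closer w≢u)

  good : All (ConnSubContaining G u v) family
  good = whole-contains linked
       ∷ All.++⁺ (All.map⁺ (All.map minusV-contains′ all-Vs))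
                 (All.++⁺ (All.map⁺ (All.map treeEdge-contains all-Es)) (extra-contains ∷ []))
    where
    minusV-contains′ : ∀ {w} → w ≢ u × w ≢ v → ConnSubContaining G u v (minusV w)
    minusV-contains′ (w≢u , w≢v) = minusV-contains (nonCut _) (w≢u ∘′ sym) (w≢v ∘′ sym)
    extra-contains : ConnSubContaining G u v (minusE farthest y)
    extra-contains = minusE-contains (nonCut _) farthest-y (parent-adj farthest≢u) (y≢parent ∘′ sym)

  distinct : Unique family
  distinct = All.++⁺ (All.map⁺ (All.map (λ _ → whole≢minusV _) all-Vs))
                     (All.++⁺ (All.map⁺ (All.map (whole≢minusE ∘′ parent-adj) all-Es))
                              (whole≢minusE farthest-y ∷ []))
           ∷ unique-++₃ (Unique.map⁺ minusV-injective (∖₂-unique (Unique.allFin⁺ n)))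
                        (unique-map⁺ treeEdge-injective all-Es (∖-unique (Unique.allFin⁺ n)))
                        ([] ∷ [])
                        (disjoint-map (λ _ _ → minusV≢minusE _ _ _) all-Vs all-Es)
                        (disjoint-map (λ {w} {x} _ _ → minusV≢minusE w x y) all-Vs is-farthest)
                        (disjoint-map treeEdge≢extra all-Es is-farthest)

  count : 2 * n ∸ 1 ≤ length family
  count rewrite length-∷-map++₃ whole minusV treeEdge (λ w → minusE w y) Vs Es (farthest ∷ []) =
    bound (length-allFin-∖₂ {u = u} {v}) (length-allFin-∖ u)
    where
    bound : ∀ {a b} → n ≤ 2 + a → n ≤ 1 + b → 2 * n ∸ 1 ≤ suc (a + (b + 1))
    bound {a} {b} n≤2+a n≤1+b = begin
      2 * n ∸ 1              ≡⟨ cong (_∸ 1) (cong (n +_) (ℕ.+-identityʳ n)) ⟩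
      (n + n) ∸ 1            ≤⟨ ℕ.∸-monoˡ-≤ 1 (ℕ.+-mono-≤ n≤2+a n≤1+b) ⟩
      (2 + a) + (1 + b) ∸ 1  ≡⟨ cong suc (cong (a +_) (ℕ.+-comm 1 b)) ⟩
      suc (a + (b + 1))      ∎
      where open ℕ.≤-Reasoning

  atLeast : fAtLeast G u v (2 * n ∸ 1)
  atLeast = atLeast-≤ {P = ConnSubContaining G u v} (atLeast-list family distinct good) count

module NontrivialComponent {n : ℕ} (G : Graph n) (3≤n : 3 ≤ n) (linked : Adjacency.Linked G)
                           (c : Fin n) (nonCut : ∀ w → w ≢ c → Adjacency.LinkedAvoiding G w)
                           {a z₀ : Fin n} (a≢c : a ≢ c) (z₀≢c : z₀ ≢ c) (az₀ : Adjacency.Adj G a z₀)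
                           (u v : Fin n) where
  open Adjacency G
  open Spanning G
  open Distance G linked c

  ToA : Fin n → Set
  ToA w = Star (AdjAvoiding c) w a

  toA? : ∀ w → Dec (ToA w)
  toA? w = Reachability.star? (AdjAvoiding? c) w a

  InC : Fin n → Set
  InC w = w ≢ c × ToA w

  InR : Fin n → Set
  InR w = w ≢ c × ¬ ToA w

  Cs : List (Fin n)
  Cs = filter toA? (allFin n ∖ c)

  Rs : List (Fin n)
  Rs = filter (λ w → ¬? (toA? w)) (allFin n ∖ c)

  Vs : List (Fin n)
  Vs = allFin n ∖ c ∖ u ∖ v

  pa : Fin n
  pa = parent a

  family : List (SubG n)
  family = whole ∷ map minusV Vs ++ map treeEdge Cs ++ map (minusEV a pa) (Rs ∖ u ∖ v)

  private
    a-pa : Adj a pa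
    a-pa = parent-adj a≢c

    a∈C : InC a
    a∈C = a≢c , ε

    unique-Vc : Unique (allFin n ∖ c)
    unique-Vc = ∖-unique (Unique.allFin⁺ n)

    unique-C : Unique Cs
    unique-C = Unique.filter⁺ toA? unique-Vc

    unique-R : Unique Rs
    unique-R = Unique.filter⁺ (λ w → ¬? (toA? w)) unique-Vc

    all-C : All InC Cs
    all-C = All.zip (All.filter⁺ toA? (∖-all (allFin n)) , All.all-filter toA? (allFin n ∖ c))

    all-R : All InR Rs
    all-R = All.zip (All.filter⁺ (λ w → ¬? (toA? w)) (∖-all (allFin n)) ,
                     All.all-filter (λ w → ¬? (toA? w)) (allFin n ∖ c))

    all-R′ : All InR (Rs ∖ u ∖ v)
    all-R′ = ∖₂-All⁺ all-R

    all-Vs : All (λ w → w ≢ c × w ≢ u × w ≢ v) Vs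
    all-Vs = All.zipWith (λ (w≢c , w≢u , w≢v) → w≢c , w≢u , w≢v)
                         (∖₂-All⁺ (∖-all (allFin n)) , ∖₂-all (allFin n ∖ c))

    C-exit : ∀ {x y} → Adj x y → InC x → ¬ InC y → y ≡ c
    C-exit {y = y} xy (x≢c , x→a) y∉C with y ≟ c
    ... | yes y≡c = y≡c
    ... | no y≢c  = contradiction (y≢c , (Adj-sym xy , y≢c , x≢c) ◅ x→a) y∉C

    R-exit : ∀ {x y} → Adj x y → InR x → ¬ InR y → y ≡ c
    R-exit {y = y} xy (x≢c , x↛a) y∉R with y ≟ c
    ... | yes y≡c = y≡c
    ... | no y≢c with toA? y
    ...   | yes y→a = contradiction ((xy , x≢c , y≢c) ◅ y→a) x↛a
    ...   | no y↛a  = contradiction (y≢c , y↛a) y∉R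

    c∉C : ¬ InC c
    c∉C (c≢c , _) = c≢c refl

    c∉R : ¬ InR c
    c∉R (c≢c , _) = c≢c refl

    C∌R : ∀ {w} → InC w → ¬ InR w
    C∌R (_ , w→a) (_ , w↛a) = w↛a w→a

    R∌a : ∀ {w} → InR w → a ≢ w
    R∌a (_ , w↛a) refl = w↛a ε

    R∌pa : ∀ {w} → InR w → pa ≢ w
    R∌pa (w≢c , w↛a) pa≡w with pa ≟ c
    ... | yes pa≡c = w≢c (trans (sym pa≡w) pa≡c)
    ... | no pa≢c  = w↛a (subst ToA pa≡w ((Adj-sym a-pa , pa≢c , a≢c) ◅ ε))

    neighbour-in-C : ∀ {w} → InC w → ∃ λ w′ → AdjAvoiding c w w′
    neighbour-in-C {w} (w≢c , w→a) with w ≟ a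
    ... | yes refl = z₀ , az₀ , a≢c , z₀≢c
    ... | no w≢a   = first-step w→a w≢a

    other-neighbour : ∀ {w} → InC w → ∃ λ w′ → Adj w w′ × w′ ≢ parent w
    other-neighbour {w} w∈C with parent w ≟ c
    ... | no pw≢c  = another-neighbour 3≤n (nonCut _ pw≢c) (parent-adj (proj₁ w∈C))
    ... | yes pw≡c = let (w′ , ww′ , _ , w′≢c) = neighbour-in-C w∈C
                     in w′ , ww′ , λ w′≡pw → w′≢c (trans w′≡pw pw≡c)

    InC? : ∀ w → Dec (InC w)
    InC? w = ¬? (w ≟ c) ×-dec toA? w

    InR? : ∀ w → Dec (InR w)
    InR? w = ¬? (w ≟ c) ×-dec ¬? (toA? w)

    to-c-without-a-pa : ∀ x → Star (Keeps noVertices (edge a pa)) x c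
    to-c-without-a-pa x = reaches x ◅◅ Star.reverse (Keeps-sym (edge-sym a pa)) (reaches c)
      where
      a′ = other-neighbour a∈C
      reaches = minusE-reaches (nonCut a a≢c) a-pa (proj₁ (proj₂ a′)) (proj₂ (proj₂ a′))

    -- Outside R, a walk to c in G − a·pa avoids w; inside R, a walk to c in G − w avoids a.
    minusEV-connected : ∀ {w} → InR w → Connected (minusEV a pa w)
    minusEV-connected {w} w∈R@(w≢c , _) = remove-connected (edge-sym a pa) c (==-≢ (w≢c ∘′ sym)) to-c
      where
      to-c : ∀ x → (x == w) ≡ false → Star (Keeps (_== w) (edge a pa)) x c
      to-c x x==w with InR? x
      ... | no x∉R = Star.map keep (bypass (Keeps-sym (edge-sym a pa)) InR? (R-exit ∘′ proj₁)
                                           (to-c-without-a-pa x) x∉R c∉R)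
        where
        ≢w : ∀ {p} → ¬ InR p → (p == w) ≡ false
        ≢w p∉R = ==-≢ λ p≡w → p∉R (subst InR (sym p≡w) w∈R)
        keep : ∀ {p q} → Outside InR (Keeps noVertices (edge a pa)) p q → Keeps (_== w) (edge a pa) p q
        keep ((pq , _ , _ , p≁q) , p∉R , q∉R) = pq , ≢w p∉R , ≢w q∉R , p≁q
      ... | yes x∈R = Star.map keep (bypass AdjAvoiding-sym InC? (C-exit ∘′ proj₁)
                                            (nonCut w w≢c x c (==-false⇒≢ x==w) (w≢c ∘′ sym))
                                            (λ x∈C → C∌R x∈C x∈R) c∉C)
        where
        ≢a : ∀ {p} → ¬ InC p → p ≢ a
        ≢a p∉C p≡a = p∉C (subst InC (sym p≡a) a∈C)
        keep : ∀ {p q} → Outside InC (AdjAvoiding w) p q → Keeps (_== w) (edge a pa) p q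
        keep ((pq , p≢w , q≢w) , p∉C , q∉C) = pq , ==-≢ p≢w , ==-≢ q≢w , edge-away (≢a p∉C) (≢a q∉C)

    minusV-contains′ : ∀ {w} → w ≢ c × w ≢ u × w ≢ v → ConnSubContaining G u v (minusV w)
    minusV-contains′ (w≢c , w≢u , w≢v) = minusV-contains (nonCut _ w≢c) (w≢u ∘′ sym) (w≢v ∘′ sym)

    treeEdge-contains : ∀ {w} → InC w → ConnSubContaining G u v (treeEdge w)
    treeEdge-contains w∈C@(w≢c , _) =
      let (w′ , ww′ , w′≢pw) = other-neighbour w∈C
      in minusE-contains (nonCut _ w≢c) (parent-adj w≢c) ww′ w′≢pw

    minusEV-contains : ∀ {w} → InR w × w ≢ u × w ≢ v → ConnSubContaining G u v (minusEV a pa w)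
    minusEV-contains (w∈R , w≢u , w≢v) =
      remove-contains (edge-sym a pa) (minusEV-connected w∈R) (==-≢ (w≢u ∘′ sym)) (==-≢ (w≢v ∘′ sym))

  good : All (ConnSubContaining G u v) family
  good = whole-contains linked
       ∷ All.++⁺ (All.map⁺ (All.map minusV-contains′ all-Vs))
                 (All.++⁺ (All.map⁺ (All.map treeEdge-contains all-C))
                          (All.map⁺ (All.map minusEV-contains (All.zip (all-R′ , ∖₂-all Rs)))))

  distinct : Unique family
  distinct = All.++⁺ (All.map⁺ (All.map (λ _ → whole≢minusV _) all-Vs))
                     (All.++⁺ (All.map⁺ (All.map (λ (w≢c , _) → whole≢minusE (parent-adj w≢c)) all-C))
                              (All.map⁺ (All.map (λ _ → whole≢minusEV a pa _) all-R′)))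
           ∷ unique-++₃ (Unique.map⁺ minusV-injective (∖₂-unique unique-Vc))
                        (unique-map⁺ (λ (w≢c , _) (w′≢c , _) → treeEdge-injective w≢c w′≢c) all-C unique-C)
                        (Unique.map⁺ minusEV-injective (∖₂-unique unique-R))
                        (disjoint-map (λ {w} {x} _ _ → minusV≢minusE w x (parent x)) all-Vs all-C)
                        (disjoint-map (λ _ x∈R → minusV≢minusEV a-pa (R∌a x∈R) (R∌pa x∈R)) all-Vs all-R′)
                        (disjoint-map (λ {w} {x} _ _ → minusE≢minusEV w (parent w) a pa x) all-C all-R′)

  private
    length-Vc : length (allFin n ∖ c) ≡ length Cs + length Rs
    length-Vc = sym (length-split toA? (allFin n ∖ c))

    n≤1+C+R : n ≤ suc (length Cs + length Rs)
    n≤1+C+R = subst (λ k → n ≤ suc k) length-Vc (length-allFin-∖ c)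

    length-family : length family ≡ suc (length Vs + (length Cs + length (Rs ∖ u ∖ v)))
    length-family = length-∷-map++₃ whole minusV treeEdge (minusEV a pa) Vs Cs (Rs ∖ u ∖ v)

  count-R-avoids : All (λ w → w ≢ u × w ≢ v) Rs → 2 * (n ∸ 1) ∸ 1 ≤ length family
  count-R-avoids R-avoids rewrite length-family | ∖₂-id R-avoids =
    2*[n∸1]∸1≤ n≤1+C+R (bound (subst (_≤ 2 + length Vs) length-Vc (length-∖₂-≥ unique-Vc)))
    where
    bound : ∀ {k s} → k ≤ 2 + s → 2 * k ≤ suc (suc (s + k))
    bound {k} {s} k≤2+s = begin
      2 * k      ≡⟨ cong (k +_) (ℕ.+-identityʳ k) ⟩
      k + k      ≤⟨ ℕ.+-monoˡ-≤ k k≤2+s ⟩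
      2 + s + k  ∎
      where open ℕ.≤-Reasoning

  count-incident : u ≡ v ⊎ u ≡ c ⊎ v ≡ c → 2 * (n ∸ 1) ∸ 1 ≤ length family
  count-incident incident rewrite length-family =
    2*[n∸1]∸1≤ n≤1+C+R (bound (subst (_≤ 1 + length Vs) length-Vc
                                      (length-∖₂-≥-incident unique-Vc (∖-all (allFin n)) incident))
                              (length-∖₂-≥-incident unique-R (All.map proj₁ all-R) incident))
    where
    bound : ∀ {c′ r r′ s} → c′ + r ≤ 1 + s → r ≤ 1 + r′ →
            2 * (c′ + r) ≤ suc (suc (s + (c′ + r′)))
    bound {c′} {r} {r′} {s} k≤1+s r≤1+r′ = begin
      2 * (c′ + r)               ≡⟨ cong ((c′ + r) +_) (ℕ.+-identityʳ (c′ + r)) ⟩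
      (c′ + r) + (c′ + r)        ≤⟨ ℕ.+-mono-≤ k≤1+s (ℕ.+-monoʳ-≤ c′ r≤1+r′) ⟩
      (1 + s) + (c′ + (1 + r′))  ≡⟨ cong (λ t → suc (s + t)) (ℕ.+-suc c′ r′) ⟩
      suc (s + suc (c′ + r′))    ≡⟨ cong suc (ℕ.+-suc s (c′ + r′)) ⟩
      suc (suc (s + (c′ + r′)))  ∎
      where open ℕ.≤-Reasoning

  atLeast : (InC u × InC v) ⊎ (u ≡ v ⊎ u ≡ c ⊎ v ≡ c) → fAtLeast G u v (2 * (n ∸ 1) ∸ 1)
  atLeast case = atLeast-≤ {P = ConnSubContaining G u v} (atLeast-list family distinct good)
                           ([ count-R-avoids ∘′ R-avoids , count-incident ]′ case)
    where
    R-avoids : InC u × InC v → All (λ w → w ≢ u × w ≢ v) Rs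
    R-avoids (u∈C , v∈C) = All.map (λ w∈R → (λ w≡u → C∌R u∈C (subst InR w≡u w∈R)) ,
                                             (λ w≡v → C∌R v∈C (subst InR w≡v w∈R))) all-R

module StarGraph {n : ℕ} (G : Graph n) (5≤n : 5 ≤ n) (c : Fin n)
                 (spoke : ∀ x → x ≢ c → Adjacency.Adj G x c)
                 (u v : Fin n) (incident : u ≡ v ⊎ u ≡ c ⊎ v ≡ c) where
  open Adjacency G
  open Spanning G

  Spare : Fin n → Set
  Spare w = w ≢ c × w ≢ u × w ≢ v

  private
    star-contains : ∀ {D} → D c ≡ false → D u ≡ false → D v ≡ false →
                    ConnSubContaining G u v (remove D noEdges)
    star-contains {D} Dc Du Dv = remove-contains noEdges-sym (remove-connected noEdges-sym c Dc to-c) Du Dv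
      where
      to-c : ∀ x → D x ≡ false → Star (Keeps D noEdges) x c
      to-c x Dx with x ≟ c
      ... | yes refl = ε
      ... | no x≢c   = (spoke x x≢c , Dx , Dc , refl) ◅ ε

    minusV-spare : ∀ {w} → Spare w → ConnSubContaining G u v (minusV w)
    minusV-spare (w≢c , w≢u , w≢v) =
      star-contains (==-≢ (w≢c ∘′ sym)) (==-≢ (w≢u ∘′ sym)) (==-≢ (w≢v ∘′ sym))

    minusVV-spare : ∀ {p q} → Spare p → Spare q → ConnSubContaining G u v (minusVV p q)
    minusVV-spare (p≢c , p≢u , p≢v) (q≢c , q≢u , q≢v) =
      star-contains (∉pair (p≢c ∘′ sym) (q≢c ∘′ sym)) (∉pair (p≢u ∘′ sym) (q≢u ∘′ sym))
                    (∉pair (p≢v ∘′ sym) (q≢v ∘′ sym))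

  fromSpares : ∀ ws → All Spare ws → Unique ws → n ≤ 2 + length ws → fAtLeast G u v (2 * (n ∸ 1) ∸ 1)
  fromSpares []           _ _ n≤2 = contradiction (ℕ.≤-trans 5≤n n≤2) λ { (s≤s (s≤s ())) }
  fromSpares (_ ∷ [])     _ _ n≤3 = contradiction (ℕ.≤-trans 5≤n n≤3) λ { (s≤s (s≤s (s≤s ()))) }
  fromSpares (_ ∷ _ ∷ []) _ _ n≤4 = contradiction (ℕ.≤-trans 5≤n n≤4) λ { (s≤s (s≤s (s≤s (s≤s ())))) }
  fromSpares ws@(w₀ ∷ w₁ ∷ w₂ ∷ rest) spare@(s₀ ∷ s₁ ∷ s₂ ∷ sᵣ)
             unique@((w₀≢w₁ ∷ w₀≢w₂ ∷ w₀∉) ∷ unique′@((w₁≢w₂ ∷ _) ∷ _)) n≤ =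
    atLeast-≤ {P = ConnSubContaining G u v} (atLeast-list family distinct good) count
    where
    ws′ : List (Fin n)
    ws′ = w₁ ∷ w₂ ∷ rest

    spare′ : All (λ x → Spare x × w₀ ≢ x) ws′
    spare′ = All.zip ((s₁ ∷ s₂ ∷ sᵣ) , (w₀≢w₁ ∷ w₀≢w₂ ∷ w₀∉))

    last : All Spare (w₂ ∷ [])
    last = s₂ ∷ []

    family : List (SubG n)
    family = whole ∷ map minusV ws ++ map (minusVV w₀) ws′ ++ map (minusVV w₁) (w₂ ∷ [])

    good : All (ConnSubContaining G u v) family
    good = star-contains refl refl refl
         ∷ All.++⁺ (All.map⁺ (All.map minusV-spare spare))
                   (All.++⁺ (All.map⁺ (All.map (minusVV-spare s₀ ∘′ proj₁) spare′))
                            (minusVV-spare s₁ s₂ ∷ []))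

    distinct : Unique family
    distinct = All.++⁺ (All.map⁺ (All.map (λ _ → whole≢minusV _) spare))
                       (All.++⁺ (All.map⁺ (All.map (λ _ → whole≢minusVV w₀ _) spare′))
                                (whole≢minusVV w₁ w₂ ∷ []))
             ∷ unique-++₃ (Unique.map⁺ minusV-injective unique)
                          (unique-map⁺ (λ (_ , w₀≢x) _ → minusVV-injective (w₀≢x ∘′ sym)) spare′ unique′)
                          ([] ∷ [])
                          (disjoint-map (λ _ (_ , w₀≢x) → minusV≢minusVV w₀≢x) spare spare′)
                          (disjoint-map (λ _ _ → minusV≢minusVV w₁≢w₂) spare last)
                          (disjoint-map (λ _ _ → minusVV≢minusVV w₀≢w₁ w₀≢w₂) spare′ last)

    count : 2 * (n ∸ 1) ∸ 1 ≤ length family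
    count rewrite length-∷-map++₃ whole minusV (minusVV w₀) (minusVV w₁) ws ws′ (w₂ ∷ []) =
      2*[n∸1]∸1≤ n≤ (ℕ.≤-reflexive (rearrange (length rest)))
      where rearrange : ∀ r → 2 * (4 + r) ≡ suc (suc ((3 + r) + ((2 + r) + 1)))
            rearrange = solve-∀

  atLeast : fAtLeast G u v (2 * (n ∸ 1) ∸ 1)
  atLeast = fromSpares (allFin n ∖ c ∖ u ∖ v)
                       (All.zipWith (λ (w≢c , w≢u , w≢v) → w≢c , w≢u , w≢v)
                                    (∖₂-All⁺ (∖-all (allFin n)) , ∖₂-all (allFin n ∖ c)))
                       (∖₂-unique unique-Vc)
                       (ℕ.≤-trans (length-allFin-∖ c)
                                  (s≤s (length-∖₂-≥-incident unique-Vc (∖-all (allFin n)) incident)))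
    where unique-Vc = ∖-unique {a = c} (Unique.allFin⁺ n)

star₄≅K13 : ∀ {n} (G : Graph n) → n ≡ 4 → (c : Fin n) → (∀ x → x ≢ c → Adjacency.Adj G x c) →
            (∀ {x y} → Adjacency.Adj G x y → x ≡ c ⊎ y ≡ c) → Iso G K13
star₄≅K13 G refl c spoke touches-c = record
  { to        = to
  ; from      = from
  ; from∘to   = λ _ → PC.transpose-inverse fz c
  ; to∘from   = λ _ → PC.transpose-inverse c fz
  ; preserves = preserves
  }
  where
  open Adjacency G

  to from : Fin 4 → Fin 4
  to   = PC.transpose c fz
  from = PC.transpose fz c

  to-c : to c ≡ fz
  to-c rewrite dec-true (c ≟ c) refl = refl

  to-leaf : ∀ {x} → x ≢ c → to x ≢ fz
  to-leaf {x} x≢c tx≡0 = x≢c (begin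
    x           ≡⟨ PC.transpose-inverse fz c ⟨
    from (to x) ≡⟨ cong from tx≡0 ⟩
    from fz     ≡⟨ from-0 ⟩
    c           ∎)
    where open ≡-Reasoning
          from-0 : from fz ≡ c
          from-0 rewrite dec-true (fz {3} ≟ fz) refl = refl

  hub-leaf : ∀ t → t ≢ fz → adj K13 fz t ≡ true
  hub-leaf fz     t≢0 = contradiction refl t≢0
  hub-leaf (fs _) _   = refl

  leaf-leaf : ∀ s t → s ≢ fz → t ≢ fz → adj K13 s t ≡ false
  leaf-leaf fz     _      s≢0 _   = contradiction refl s≢0
  leaf-leaf (fs _) fz     _   t≢0 = contradiction refl t≢0
  leaf-leaf (fs _) (fs _) _   _   = refl

  preserves : ∀ x y → adj K13 (to x) (to y) ≡ adj G x y
  preserves x y = by-cases (x ≟ c) (y ≟ c)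
    where
    by-cases : Dec (x ≡ c) → Dec (y ≡ c) → adj K13 (to x) (to y) ≡ adj G x y
    by-cases (yes refl) (yes refl) rewrite to-c = sym (irrefl G x)
    by-cases (yes refl) (no y≢c)   rewrite to-c =
      trans (hub-leaf (to y) (to-leaf y≢c)) (sym (Adj-sym (spoke y y≢c)))
    by-cases (no x≢c)   (yes refl) rewrite to-c =
      trans (trans (adj-sym K13 (to x) fz) (hub-leaf (to x) (to-leaf x≢c))) (sym (spoke x x≢c))
    by-cases (no x≢c)   (no y≢c)   =
      trans (leaf-leaf (to x) (to y) (to-leaf x≢c) (to-leaf y≢c))
            (sym (Bool.¬-not λ xy → [ x≢c , y≢c ]′ (touches-c xy)))

module OneCutVertex {n : ℕ} (G : Graph n) (4≤n : 4 ≤ n) (connected : ConnectedGraph G)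
                    (¬K13 : ¬ Iso G K13) (c : Fin n) (only-c : ∀ w → w ≢ c → ¬ IsCutVertex G w) where
  open Adjacency G

  private
    3≤n : 3 ≤ n
    3≤n = ℕ.≤-trans (ℕ.n≤1+n 3) 4≤n

    linked : Linked
    linked = connected⇒linked connected

    nonCut : ∀ w → w ≢ c → LinkedAvoiding w
    nonCut w w≢c = nonCut⇒linkedAvoiding w (only-c w w≢c)

    edge-avoiding? : Dec (∃ λ a → ∃ λ z → AdjAvoiding c a z)
    edge-avoiding? = Fin.any? λ a → Fin.any? λ z → AdjAvoiding? c a z

  module _ (no-edge : ¬ ∃ λ a → ∃ λ z → AdjAvoiding c a z) where

    touches-c : ∀ {x y} → Adj x y → x ≡ c ⊎ y ≡ c
    touches-c {x} {y} xy with x ≟ c | y ≟ c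
    ... | yes x≡c | _       = inj₁ x≡c
    ... | no _    | yes y≡c = inj₂ y≡c
    ... | no x≢c  | no y≢c  = contradiction (x , y , xy , x≢c , y≢c) no-edge

    spoke : ∀ x → x ≢ c → Adj x c
    spoke x x≢c with first-step (linked x c) x≢c
    ... | y , xy with touches-c xy
    ...   | inj₁ x≡c = contradiction x≡c x≢c
    ...   | inj₂ y≡c = subst (Adj x) y≡c xy

  atLeast : ∀ {B} → IsBlock G B → ∀ {u v} → inV B u → inV B v → fAtLeast G u v (2 * (n ∸ 1) ∸ 1)
  atLeast block {u} {v} u∈B v∈B with (u ≟ v) ⊎-dec (u ≟ c) ⊎-dec (v ≟ c)
  ... | no ¬incident =
    NontrivialComponent.atLeast G 3≤n linked c nonCut u≢c z₀≢c uz₀ u v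
                                (inj₁ ((u≢c , ε) , (v≢c , Star.reverse AdjAvoiding-sym u→v)))
    where
    u≢v = ¬incident ∘′ inj₁
    u≢c = ¬incident ∘′ inj₂ ∘′ inj₁
    v≢c = ¬incident ∘′ inj₂ ∘′ inj₂
    u→v = block-linkedAvoiding block u∈B v∈B u≢c v≢c
    z₀   = proj₁ (first-step u→v u≢v)
    uz₀  = proj₁ (proj₂ (first-step u→v u≢v))
    z₀≢c = proj₂ (proj₂ (proj₂ (first-step u→v u≢v)))
  ... | yes incident with edge-avoiding?
  ...   | yes (a , z₀ , az₀ , a≢c , z₀≢c) =
    NontrivialComponent.atLeast G 3≤n linked c nonCut a≢c z₀≢c az₀ u v (inj₂ incident)
  ...   | no no-edge with 5 ≤? n
  ...     | yes 5≤n = StarGraph.atLeast G 5≤n c (spoke no-edge) u v incident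
  ...     | no 5≰n  = contradiction (star₄≅K13 G (ℕ.≤-antisym (ℕ.≤-pred (ℕ.≰⇒> 5≰n)) 4≤n) c
                                               (spoke no-edge) (touches-c no-edge)) ¬K13

lemma3p4 : (k n : ℕ) → k ≤ 1 → k + 3 ≤ n → (G : Graph n) →
    ConnectedGraph G → ExactlyCutVertices G k → ¬ Iso G K13 →
    (B : SubG n) → IsBlock G B → (u v : Fin n) → inV B u → inV B v →
    fAtLeast G u v (2 * (n ∸ k) ∸ 1)
lemma3p4 zero n _ 3≤n G connected (_ , _ , listed , _) _ _ _ u v _ _ =
  NoCutVertex.atLeast G 3≤n (connected⇒linked connected) nonCut u v
  where
  open Adjacency G
  nonCut : ∀ w → LinkedAvoiding w
  nonCut w = nonCut⇒linkedAvoiding w (Fin.¬Fin0 ∘′ proj₁ ∘′ listed w)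
lemma3p4 (suc zero) n _ 4≤n G connected (cut , _ , listed , _) ¬K13 _ block u v u∈B v∈B =
  OneCutVertex.atLeast G 4≤n connected ¬K13 (cut fz) only-c block u∈B v∈B
  where
  only-c : ∀ w → w ≢ cut fz → ¬ IsCutVertex G w
  only-c w w≢c w-cut with listed w w-cut
  ... | fz , c≡w = w≢c (sym c≡w)
lemma3p4 (suc (suc _)) _ (s≤s ()) _ _ _ _ _ _ _ _ _ _ _
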